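{- For every integer $n\ge 4$ there is an $n\times 4$ matrix $A_n=(a_{ij})$ such that: (i) $a_{ij}\in\mathbb{N}$ for all $i\in[n]$, $j\in[4]$; (ii) $a_{ik}\ne a_{jk}$ for all $1\le i<j\le n$ and $k\in[4]$; (iii) there exist $j,k\in[4]$ with $j\ne k$ such that $a_{nj}=\max\{a_{lj}: l\in[n]\}$ and $a_{1k}=\min\{a_{lk}: l\in[n]\}$; (iv) $|\{k\in[4]: a_{ik}-a_{(i+1)k}>0\}|=3$ for all $i\in[n]$, where the row index $n+1$ is identified with $1$; (v) $|\{k\in[4]: a_{ik}-a_{jk}>0\}|=2$ for all $i,j\in[n]$ with $|i-j|\ge 2$ and $\{i,j\}\ne\{1,n\}$.
   Context: $[m]=\{1,\dots,m\}$ for a positive integer $m$; $\mathbb{N}$ denotes the natural numbers. -}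

module Defs where

open import Data.Nat using (ℕ; zero; suc; _+_; _<_; _≤_; _>_; _≥_; _<?_)
open import Data.Fin using (Fin; toℕ; fromℕ; inject₁) renaming (zero to fzero; suc to fsuc)
open import Data.Product using (Σ; _×_; _,_; ∃-syntax)
open import Relation.Nullary using (¬_; yes; no)
open import Relation.Binary.PropositionalEquality using (_≡_)
open import Data.Empty using (⊥)

-- Matrices with m rows and k columns over ℕ (rows and columns 0-indexed:
-- row i of the Agda matrix is row i+1 of the paper).
Matrix : ℕ → ℕ → Set
Matrix m k = Fin m → Fin k → ℕ

countGreater : ∀ {m k} → Matrix m k → Fin m → Fin m → ℕ
countGreater {k = k} a i j = go k (λ c → a i c) (λ c → a j c)
  where
  go : (k : ℕ) → (Fin k → ℕ) → (Fin k → ℕ) → ℕ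
  go zero    f g = 0
  go (suc k) f g with g fzero <? f fzero
  ... | yes _ = suc (go k (λ c → f (fsuc c)) (λ c → g (fsuc c)))
  ... | no  _ = go k (λ c → f (fsuc c)) (λ c → g (fsuc c))

-- cyclic successor on rows: row i ↦ row i+1, last row ↦ first row
next : ∀ {n} → Fin (suc n) → Fin (suc n)
next {zero}  fzero = fzero
next {suc n} fzero = fsuc fzero
next {suc n} (fsuc i) with next {n} i
... | fzero  = fzero
... | fsuc j = fsuc (fsuc j)

dist : ℕ → ℕ → ℕ
dist zero    j       = j
dist (suc i) zero    = suc i
dist (suc i) (suc j) = dist i j

-- The properties (i)–(v) for an n×4 matrix, n = suc m (paper's n).
Property : (m : ℕ) → Matrix (suc m) 4 → Set
Property m a =
    (∀ (i j : Fin (suc m)) (c : Fin 4) → toℕ i < toℕ j → ¬ (a i c ≡ a j c))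
  ×
    (Σ (Fin 4) λ j → Σ (Fin 4) λ k → ¬ (j ≡ k)
        × (∀ l → a l j ≤ a (fromℕ m) j)
        × (∀ l → a fzero k ≤ a l k))
  ×
    (∀ (i : Fin (suc m)) → countGreater a i (next i) ≡ 3)
  ×
    (∀ (i j : Fin (suc m)) → dist (toℕ i) (toℕ j) ≥ 2
        → ¬ (toℕ i ≡ 0 × toℕ j ≡ m) → ¬ (toℕ i ≡ m × toℕ j ≡ 0)
        → countGreater a i j ≡ 2)

-- 1. Rows are compared column by column (`Comparison`); `countGreater` of a
--    four-column matrix counts the columns won by the first row.
-- 2. `pattern⇒property`: all of (i)–(v) follow from a `CyclicPattern` — each
--    row beats its cyclic successor in 3 columns and any two other rows, except
--    first and last, split the columns 2 : 2 — plus one column with its maximum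
--    in the last row and another with its minimum in the first row.
-- 3. The matrix: a body of b rows r ↦ (2(b∸r), 2(b∸r), 2·swap r, 2·swap (r+1)),
--    where swap exchanges 2k ↔ 2k+1.  The first two columns fall at every step,
--    the swap columns fall at alternate steps, and rows at least two apart rise
--    in both swap columns.  For b = 3 + e with e even the cycle is closed by one
--    extra row (n even) or two extra rows (n odd), whose entries are odd, i.e.
--    slotted between the even body entries.

module Submission where

open import Defs
open import Data.Nat using (ℕ; zero; suc; pred; _+_; _∸_; _≤_; _<_; _≥_; z≤n; s≤s; z<s; _<?_)
open import Data.Nat.Properties
  using ( <-irrefl; <-asym; <-trans; ≤-refl; ≤-trans; ≤-total; <⇒≤; ≤-pred; n≤1+n; n<1+n
        ; m≤n⇒m<n∨m≡n; +-suc; +-identityʳ; +-cancelˡ-≡; m∸n≤m; ∸-monoʳ-<; m<n⇒0<n∸m )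
open import Data.Nat.Tactic.RingSolver using (solve-∀)
open import Data.Fin using (Fin; toℕ; fromℕ) renaming (zero to fzero; suc to fsuc)
open import Data.Fin.Properties using (toℕ<n; toℕ-fromℕ)
open import Data.Product using (Σ; _×_; _,_; proj₁)
open import Data.Sum using (_⊎_; inj₁; inj₂)
open import Relation.Nullary using (¬_; Dec; yes; no; contradiction)
open import Relation.Binary.PropositionalEquality
  using (_≡_; _≢_; refl; sym; trans; cong; cong₂; subst; subst₂; module ≡-Reasoning)

Row : Set
Row = Fin 4 → ℕ

c₀ c₁ c₂ c₃ : Fin 4
c₀ = fzero
c₁ = fsuc fzero
c₂ = fsuc (fsuc fzero)
c₃ = fsuc (fsuc (fsuc fzero))

row : ℕ → ℕ → ℕ → ℕ → Row
row x₀ x₁ x₂ x₃ fzero                      = x₀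
row x₀ x₁ x₂ x₃ (fsuc fzero)               = x₁
row x₀ x₁ x₂ x₃ (fsuc (fsuc fzero))        = x₂
row x₀ x₁ x₂ x₃ (fsuc (fsuc (fsuc fzero))) = x₃

bit : ∀ {p} {P : Set p} → Dec P → ℕ
bit (yes _) = 1
bit (no _)  = 0

score : Row → Row → ℕ
score f g =
  bit (g c₀ <? f c₀) + (bit (g c₁ <? f c₁) + (bit (g c₂ <? f c₂) + bit (g c₃ <? f c₃)))

countGreater≡score : ∀ {m} (a : Matrix m 4) i j → countGreater a i j ≡ score (a i) (a j)
countGreater≡score a i j with a j c₀ <? a i c₀
countGreater≡score a i j | yes _ with a j c₁ <? a i c₁
countGreater≡score a i j | yes _ | yes _ with a j c₂ <? a i c₂
countGreater≡score a i j | yes _ | yes _ | yes _ with a j c₃ <? a i c₃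
countGreater≡score a i j | yes _ | yes _ | yes _ | yes _ = refl
countGreater≡score a i j | yes _ | yes _ | yes _ | no  _ = refl
countGreater≡score a i j | yes _ | yes _ | no  _ with a j c₃ <? a i c₃
countGreater≡score a i j | yes _ | yes _ | no  _ | yes _ = refl
countGreater≡score a i j | yes _ | yes _ | no  _ | no  _ = refl
countGreater≡score a i j | yes _ | no  _ with a j c₂ <? a i c₂
countGreater≡score a i j | yes _ | no  _ | yes _ with a j c₃ <? a i c₃
countGreater≡score a i j | yes _ | no  _ | yes _ | yes _ = refl
countGreater≡score a i j | yes _ | no  _ | yes _ | no  _ = refl
countGreater≡score a i j | yes _ | no  _ | no  _ with a j c₃ <? a i c₃
countGreater≡score a i j | yes _ | no  _ | no  _ | yes _ = refl
countGreater≡score a i j | yes _ | no  _ | no  _ | no  _ = refl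
countGreater≡score a i j | no  _ with a j c₁ <? a i c₁
countGreater≡score a i j | no  _ | yes _ with a j c₂ <? a i c₂
countGreater≡score a i j | no  _ | yes _ | yes _ with a j c₃ <? a i c₃
countGreater≡score a i j | no  _ | yes _ | yes _ | yes _ = refl
countGreater≡score a i j | no  _ | yes _ | yes _ | no  _ = refl
countGreater≡score a i j | no  _ | yes _ | no  _ with a j c₃ <? a i c₃
countGreater≡score a i j | no  _ | yes _ | no  _ | yes _ = refl
countGreater≡score a i j | no  _ | yes _ | no  _ | no  _ = refl
countGreater≡score a i j | no  _ | no  _ with a j c₂ <? a i c₂
countGreater≡score a i j | no  _ | no  _ | yes _ with a j c₃ <? a i c₃
countGreater≡score a i j | no  _ | no  _ | yes _ | yes _ = refl
countGreater≡score a i j | no  _ | no  _ | yes _ | no  _ = refl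
countGreater≡score a i j | no  _ | no  _ | no  _ with a j c₃ <? a i c₃
countGreater≡score a i j | no  _ | no  _ | no  _ | yes _ = refl
countGreater≡score a i j | no  _ | no  _ | no  _ | no  _ = refl

data Order (x y : ℕ) : Set where
  above : y < x → Order x y
  below : x < y → Order x y

win : ∀ {x y} → Order x y → ℕ
win (above _) = 1
win (below _) = 0

flip : ∀ {x y} → Order x y → Order y x
flip (above p) = below p
flip (below p) = above p

order-≢ : ∀ {x y} → Order x y → x ≢ y
order-≢ (above p) x≡y = <-irrefl (sym x≡y) p
order-≢ (below p) x≡y = <-irrefl x≡y p

bit≡win : ∀ {x y} (o : Order x y) → bit (y <? x) ≡ win o
bit≡win {x} {y} (above p) with y <? x
... | yes _  = refl
... | no y≮x = contradiction p y≮x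
bit≡win {x} {y} (below p) with y <? x
... | yes y<x = contradiction y<x (<-asym p)
... | no _    = refl

win-flip : ∀ {x y} (o : Order x y) → win o + win (flip o) ≡ 1
win-flip (above _) = refl
win-flip (below _) = refl

map-order : ∀ {f : ℕ → ℕ} → (∀ {a b} → a < b → f a < f b)
          → ∀ {x y} → Order x y → Order (f x) (f y)
map-order mono (above p) = above (mono p)
map-order mono (below p) = below (mono p)

win-map : ∀ {f : ℕ → ℕ} (mono : ∀ {a b} → a < b → f a < f b) {x y} (o : Order x y)
        → win (map-order {f} mono o) ≡ win o
win-map mono (above _) = refl
win-map mono (below _) = refl

infix 5 _∣_∣_∣_
data Comparison (f g : Row) : Set where
  _∣_∣_∣_ : Order (f c₀) (g c₀) → Order (f c₁) (g c₁)
          → Order (f c₂) (g c₂) → Order (f c₃) (g c₃) → Comparison f g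

wins : ∀ {f g} → Comparison f g → ℕ
wins (o₀ ∣ o₁ ∣ o₂ ∣ o₃) = win o₀ + (win o₁ + (win o₂ + win o₃))

reverse : ∀ {f g} → Comparison f g → Comparison g f
reverse (o₀ ∣ o₁ ∣ o₂ ∣ o₃) = flip o₀ ∣ flip o₁ ∣ flip o₂ ∣ flip o₃

score≡wins : ∀ {f g} (cs : Comparison f g) → score f g ≡ wins cs
score≡wins (o₀ ∣ o₁ ∣ o₂ ∣ o₃) =
  cong₂ _+_ (bit≡win o₀) (cong₂ _+_ (bit≡win o₁) (cong₂ _+_ (bit≡win o₂) (bit≡win o₃)))

-- Every column is won by exactly one of the two rows.
wins-reverse : ∀ {f g} (cs : Comparison f g) → wins cs + wins (reverse cs) ≡ 4
wins-reverse cs@(o₀ ∣ o₁ ∣ o₂ ∣ o₃) = begin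
  wins cs + wins (reverse cs)
    ≡⟨ interchange (win o₀) (win o₁) (win o₂) (win o₃)
                   (win (flip o₀)) (win (flip o₁)) (win (flip o₂)) (win (flip o₃)) ⟩
  (win o₀ + win (flip o₀)) + ((win o₁ + win (flip o₁))
    + ((win o₂ + win (flip o₂)) + (win o₃ + win (flip o₃))))
    ≡⟨ cong₂ _+_ (win-flip o₀)
         (cong₂ _+_ (win-flip o₁) (cong₂ _+_ (win-flip o₂) (win-flip o₃))) ⟩
  4 ∎
  where
  open ≡-Reasoning
  interchange : ∀ a b c d a′ b′ c′ d′ → (a + (b + (c + d))) + (a′ + (b′ + (c′ + d′)))
              ≡ (a + a′) + ((b + b′) + ((c + c′) + (d + d′)))
  interchange = solve-∀

separated : ∀ {f g} → Comparison f g → ∀ c → f c ≢ g c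
separated (o₀ ∣ o₁ ∣ o₂ ∣ o₃) fzero                      = order-≢ o₀
separated (o₀ ∣ o₁ ∣ o₂ ∣ o₃) (fsuc fzero)               = order-≢ o₁
separated (o₀ ∣ o₁ ∣ o₂ ∣ o₃) (fsuc (fsuc fzero))        = order-≢ o₂
separated (o₀ ∣ o₁ ∣ o₂ ∣ o₃) (fsuc (fsuc (fsuc fzero))) = order-≢ o₃

Outscores : ℕ → Row → Row → Set
Outscores k f g = Σ (Comparison f g) λ cs → wins cs ≡ k

score-of : ∀ {k f g} → Outscores k f g → score f g ≡ k
score-of (cs , w) = trans (score≡wins cs) w

balanced-reverse : ∀ {f g} → Outscores 2 f g → Outscores 2 g f
balanced-reverse (cs , w) =
  reverse cs , +-cancelˡ-≡ 2 _ _ (trans (cong (_+ wins (reverse cs)) (sym w)) (wins-reverse cs))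

transport : ∀ {k f f′ g g′} → f′ ≡ f → g′ ≡ g → Outscores k f g → Outscores k f′ g′
transport {k} f′≡f g′≡g = subst₂ (Outscores k) (sym f′≡f) (sym g′≡g)

record CyclicPattern (m : ℕ) (V : ℕ → Row) : Set where
  field
    step    : ∀ {i} → i < m → Outscores 3 (V i) (V (suc i))
    wrap    : Outscores 3 (V m) (V 0)
    distant : ∀ {i j} → 2 + i ≤ j → j ≤ m → 0 < i ⊎ j < m → Outscores 2 (V i) (V j)

next-< : ∀ {n} (i : Fin (suc n)) → toℕ i < n → toℕ (next i) ≡ suc (toℕ i)
next-< {suc n} fzero    _       = refl
next-< {suc n} (fsuc i) (s≤s h) with next i | next-< i h
... | fsuc j | e = cong suc e

next-last : ∀ {n} (i : Fin (suc n)) → toℕ i ≡ n → toℕ (next i) ≡ 0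
next-last {zero}  fzero    _ = refl
next-last {suc n} (fsuc i) e with next i | next-last i (cong pred e)
... | fzero | _ = refl

far-apart : ∀ {r s} → r ≤ s → 2 ≤ dist r s → 2 + r ≤ s
far-apart {zero}  _       d = d
far-apart {suc r} (s≤s h) d = s≤s (far-apart h d)

dist-sym : ∀ r s → dist r s ≡ dist s r
dist-sym zero    zero    = refl
dist-sym zero    (suc s) = refl
dist-sym (suc r) zero    = refl
dist-sym (suc r) (suc s) = dist-sym r s

not-first-and-last : ∀ {i j m} → j ≤ m → ¬ (i ≡ 0 × j ≡ m) → 0 < i ⊎ j < m
not-first-and-last {suc i} _ _ = inj₁ z<s
not-first-and-last {zero} j≤m ¬ends with m≤n⇒m<n∨m≡n j≤m
... | inj₁ j<m = inj₂ j<m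
... | inj₂ j≡m = contradiction (refl , j≡m) ¬ends

module _ {m : ℕ} {V : ℕ → Row} (P : CyclicPattern m V) where
  open CyclicPattern P

  -- any two different rows are compared, so they differ in every column
  compare : ∀ {i j} → i < j → j ≤ m → Comparison (V i) (V j)
  compare {i} i<j j≤m with m≤n⇒m<n∨m≡n i<j
  ... | inj₂ refl = proj₁ (step j≤m)
  ... | inj₁ 2+i≤j with i | m≤n⇒m<n∨m≡n j≤m
  ...   | suc _ | _         = proj₁ (distant 2+i≤j j≤m (inj₁ z<s))
  ...   | zero  | inj₁ j<m  = proj₁ (distant 2+i≤j j≤m (inj₂ j<m))
  ...   | zero  | inj₂ refl = reverse (proj₁ wrap)

  pattern⇒property : (j k : Fin 4) → j ≢ k
    → (∀ r → r ≤ m → V r j ≤ V m j) → (∀ r → r ≤ m → V 0 k ≤ V r k)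
    → Property m (λ i → V (toℕ i))
  pattern⇒property j k j≢k top bottom = distinct , extremes , consecutive , apart
    where
    a : Matrix (suc m) 4
    a i = V (toℕ i)

    bound : (i : Fin (suc m)) → toℕ i ≤ m
    bound i = ≤-pred (toℕ<n i)

    distinct : ∀ (i i′ : Fin (suc m)) (c : Fin 4) → toℕ i < toℕ i′ → ¬ (a i c ≡ a i′ c)
    distinct i i′ c i<i′ = separated (compare i<i′ (bound i′)) c

    extremes : Σ (Fin 4) λ j → Σ (Fin 4) λ k → ¬ (j ≡ k)
               × (∀ l → a l j ≤ a (fromℕ m) j) × (∀ l → a fzero k ≤ a l k)
    extremes = j , k , j≢k
             , (λ l → subst (λ t → a l j ≤ V t j) (sym (toℕ-fromℕ m)) (top (toℕ l) (bound l)))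
             , (λ l → bottom (toℕ l) (bound l))

    consecutive : ∀ i → countGreater a i (next i) ≡ 3
    consecutive i rewrite countGreater≡score a i (next i) with m≤n⇒m<n∨m≡n (bound i)
    ... | inj₁ i<m rewrite next-< i i<m = score-of (step i<m)
    ... | inj₂ i≡m rewrite next-last i i≡m | i≡m = score-of wrap

    apart : ∀ (i i′ : Fin (suc m)) → dist (toℕ i) (toℕ i′) ≥ 2
          → ¬ (toℕ i ≡ 0 × toℕ i′ ≡ m) → ¬ (toℕ i ≡ m × toℕ i′ ≡ 0)
          → countGreater a i i′ ≡ 2
    apart i i′ d ¬first-last ¬last-first rewrite countGreater≡score a i i′
      with ≤-total (toℕ i) (toℕ i′)
    ... | inj₁ i≤i′ =
      score-of (distant (far-apart i≤i′ d) (bound i′) (not-first-and-last (bound i′) ¬first-last))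
    ... | inj₂ i′≤i =
      score-of (balanced-reverse
        (distant (far-apart i′≤i d′) (bound i) (not-first-and-last (bound i) ¬first-last′)))
      where
      d′ : 2 ≤ dist (toℕ i′) (toℕ i)
      d′ = subst (2 ≤_) (dist-sym (toℕ i) (toℕ i′)) d
      ¬first-last′ : ¬ (toℕ i′ ≡ 0 × toℕ i ≡ m)
      ¬first-last′ (i′≡0 , i≡m) = ¬last-first (i≡m , i′≡0)

swap : ℕ → ℕ
swap zero          = 1
swap (suc zero)    = 0
swap (suc (suc r)) = suc (suc (swap r))

swap-≤ : ∀ r → swap r ≤ suc r
swap-≤ zero          = ≤-refl
swap-≤ (suc zero)    = z≤n
swap-≤ (suc (suc r)) = s≤s (s≤s (swap-≤ r))

swap-apart : ∀ {r s} → 2 + r ≤ s → swap r < swap s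
swap-apart {zero}        {suc zero}    (s≤s ())
swap-apart {zero}        {suc (suc s)} _                 = s≤s (s≤s z≤n)
swap-apart {suc zero}    {suc zero}    (s≤s ())
swap-apart {suc zero}    {suc (suc s)} _                 = z<s
swap-apart {suc (suc r)} {suc (suc s)} (s≤s (s≤s 2+r≤s)) = s≤s (s≤s (swap-apart 2+r≤s))

swap-step : ∀ r → Σ (Order (swap r) (swap (1 + r))) λ o
                → Σ (Order (swap (1 + r)) (swap (2 + r))) λ o′ → win o + win o′ ≡ 1
swap-step zero          = above z<s , below (s≤s z≤n) , refl
swap-step (suc zero)    = below z<s , above (s≤s (s≤s (s≤s z≤n))) , refl
swap-step (suc (suc r)) with swap-step r
... | o , o′ , one = map-order shift o , map-order shift o′
                   , trans (cong₂ _+_ (win-map shift o) (win-map shift o′)) one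
  where shift : ∀ {a b} → a < b → 2 + a < 2 + b
        shift a<b = s≤s (s≤s a<b)

-- Entries come in levels: body entries are the even numbers lo x = 2x, and an
-- extra row's entry hi x = 2x + 1 sits strictly between lo x and lo (x + 1).
lo : ℕ → ℕ
lo zero    = zero
lo (suc x) = suc (suc (lo x))

hi : ℕ → ℕ
hi x = suc (lo x)

lo<hi : ∀ {x y} → x ≤ y → lo x < hi y
lo<hi z≤n       = s≤s z≤n
lo<hi (s≤s x≤y) = s≤s (s≤s (lo<hi x≤y))

hi<lo : ∀ {x y} → x < y → hi x < lo y
hi<lo (s≤s x≤y) = s≤s (lo<hi x≤y)

lo<lo : ∀ {x y} → x < y → lo x < lo y
lo<lo x<y = <⇒≤ (hi<lo x<y)

hi<hi : ∀ {x y} → x < y → hi x < hi y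
hi<hi x<y = s≤s (lo<lo x<y)

apart⇒< : ∀ {i j} → 2 + i ≤ j → i < j
apart⇒< 2+i≤j = ≤-trans (n≤1+n _) 2+i≤j

body : ℕ → ℕ → Row
body b r = row (lo (b ∸ r)) (lo (b ∸ r)) (lo (swap r)) (lo (swap (suc r)))

-- consecutive body rows: both falling columns and one swap column drop
body-step : ∀ {b i} → suc i ≤ b → Outscores 3 (body b i) (body b (suc i))
body-step {b} {i} 1+i≤b with swap-step i
... | o , o′ , one =
  (above falls ∣ above falls ∣ map-order lo<lo o ∣ map-order lo<lo o′)
  , cong (λ w → 2 + w) (trans (cong₂ _+_ (win-map lo<lo o) (win-map lo<lo o′)) one)
  where falls : lo (b ∸ suc i) < lo (b ∸ i)
        falls = lo<lo (∸-monoʳ-< (n<1+n i) 1+i≤b)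

-- distant body rows: the falling columns drop, both swap columns rise
body-distant : ∀ {b i j} → 2 + i ≤ j → j ≤ b → Outscores 2 (body b i) (body b j)
body-distant {b} {i} {j} 2+i≤j j≤b =
  (above falls ∣ above falls
   ∣ below (lo<lo (swap-apart 2+i≤j)) ∣ below (lo<lo (swap-apart (s≤s 2+i≤j)))) , refl
  where falls : lo (b ∸ j) < lo (b ∸ i)
        falls = lo<lo (∸-monoʳ-< (apart⇒< 2+i≤j) j≤b)

stack : ℕ → (ℕ → Row) → (ℕ → Row) → ℕ → Row
stack zero    f t r       = t r
stack (suc b) f t zero    = f zero
stack (suc b) f t (suc r) = stack b (λ r′ → f (suc r′)) t r

stack-body : ∀ {b f t r} → r < b → stack b f t r ≡ f r
stack-body {suc b} {r = zero}  _       = refl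
stack-body {suc b} {r = suc r} (s≤s h) = stack-body {b} h

stack-tail : ∀ b {f t} s → stack b f t (s + b) ≡ t s
stack-tail zero    {t = t} s = cong t (+-identityʳ s)
stack-tail (suc b)         s rewrite +-suc s b = stack-tail b s

-- The construction for a body of height b = 3 + e with e even, so that the
-- last body row 2 + e holds the upper entry 3 + e of its swap pair.
module Construction (e : ℕ) (e-even : swap e ≡ suc e) where

  b : ℕ
  b = 3 + e

  last-swap : 2 + e < swap (2 + e)
  last-swap = s≤s (s≤s (subst (e <_) (sym e-even) ≤-refl))

  body-low : ∀ r → lo (b ∸ r) ≤ hi b
  body-low r = <⇒≤ (lo<hi (m∸n≤m b r))

  -- n = 4 + e: one closing row, the maximum of column 0, the minimum of column 1.
  module EvenRows where
    closing : Row
    closing = row (hi b) (hi 0) (hi (2 + e)) (hi 0)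

    rows : ℕ → Row
    rows = stack b (body b) (λ _ → closing)

    rows-body : ∀ {r} → r < b → rows r ≡ body b r
    rows-body = stack-body {b} {body b} {λ _ → closing}

    rows-closing : rows b ≡ closing
    rows-closing = stack-tail b {body b} {λ _ → closing} 0

    between-body : ∀ {k i j} → i < j → j < b
                 → Outscores k (body b i) (body b j) → Outscores k (rows i) (rows j)
    between-body i<j j<b = transport (rows-body (<-trans i<j j<b)) (rows-body j<b)

    into-closing : Outscores 3 (body b (2 + e)) closing
    into-closing =
      (below (lo<hi (m∸n≤m b (2 + e))) ∣ above (hi<lo (m<n⇒0<n∸m (n<1+n (2 + e))))
       ∣ above (hi<lo last-swap) ∣ above (hi<lo z<s)) , refl

    closing-first : Outscores 3 closing (body b 0)
    closing-first =
      (above (lo<hi ≤-refl) ∣ below (hi<lo z<s)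
       ∣ above (lo<hi (s≤s z≤n)) ∣ above (lo<hi z≤n)) , refl

    inner-closing : ∀ {i} → 1 ≤ i → 2 + i ≤ b → Outscores 2 (body b i) closing
    inner-closing {suc i} _ 3+i≤b =
      (below (lo<hi (m∸n≤m b (suc i))) ∣ above (hi<lo (m<n⇒0<n∸m (apart⇒< 3+i≤b)))
       ∣ below (lo<hi (≤-trans (swap-≤ (suc i)) (≤-pred 3+i≤b))) ∣ above (hi<lo z<s)) , refl

    cyclic : CyclicPattern b rows
    cyclic = record { step = step ; wrap = wrap ; distant = distant }
      where
      step : ∀ {i} → i < b → Outscores 3 (rows i) (rows (suc i))
      step {i} i<b with m≤n⇒m<n∨m≡n i<b
      ... | inj₁ 1+i<b = between-body (n<1+n i) 1+i<b (body-step (<⇒≤ 1+i<b))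
      ... | inj₂ refl  = transport (rows-body i<b) rows-closing into-closing

      wrap : Outscores 3 (rows b) (rows 0)
      wrap = transport rows-closing refl closing-first

      distant : ∀ {i j} → 2 + i ≤ j → j ≤ b → 0 < i ⊎ j < b → Outscores 2 (rows i) (rows j)
      distant 2+i≤j j≤b ends with m≤n⇒m<n∨m≡n j≤b | ends
      ... | inj₁ j<b  | _        = between-body (apart⇒< 2+i≤j) j<b (body-distant 2+i≤j j≤b)
      ... | inj₂ refl | inj₁ 0<i =
        transport (rows-body (apart⇒< 2+i≤j)) rows-closing (inner-closing 0<i 2+i≤j)
      ... | inj₂ refl | inj₂ b<b = contradiction b<b (<-irrefl refl)

    top : ∀ r → r ≤ b → rows r c₀ ≤ rows b c₀
    top r r≤b rewrite rows-closing with m≤n⇒m<n∨m≡n r≤b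
    ... | inj₁ r<b  rewrite rows-body r<b = body-low r
    ... | inj₂ refl rewrite rows-closing  = ≤-refl

    -- column 3 has its minimum lo 0 = 0 in the first row
    property : Property b (λ i → rows (toℕ i))
    property = pattern⇒property cyclic c₀ c₃ (λ ()) top (λ _ _ → z≤n)

  -- n = 5 + e: a penultimate row just below the top of column 1, and a closing
  -- row, the maximum of column 0.
  module OddRows where
    penultimate closing : Row
    penultimate = row (hi 0) (hi (2 + e)) (hi (2 + e)) (hi 1)
    closing     = row (hi b) (hi (1 + e)) (hi 1) (hi 0)

    extra : ℕ → Row
    extra zero    = penultimate
    extra (suc _) = closing

    rows : ℕ → Row
    rows = stack b (body b) extra

    rows-body : ∀ {r} → r < b → rows r ≡ body b r
    rows-body = stack-body {b} {body b} {extra}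

    rows-penultimate : rows b ≡ penultimate
    rows-penultimate = stack-tail b {body b} {extra} 0

    rows-closing : rows (suc b) ≡ closing
    rows-closing = stack-tail b {body b} {extra} 1

    between-body : ∀ {k i j} → i < j → j < b
                 → Outscores k (body b i) (body b j) → Outscores k (rows i) (rows j)
    between-body i<j j<b = transport (rows-body (<-trans i<j j<b)) (rows-body j<b)

    into-penultimate : Outscores 3 (body b (2 + e)) penultimate
    into-penultimate =
      (above (hi<lo (m<n⇒0<n∸m (n<1+n (2 + e))))
       ∣ below (lo<hi (≤-trans (m∸n≤m (suc e) e) (n≤1+n _)))
       ∣ above (hi<lo last-swap) ∣ above (hi<lo (s≤s (s≤s z≤n)))) , refl

    penultimate-closing : Outscores 3 penultimate closing
    penultimate-closing =
      (below (hi<hi z<s) ∣ above (hi<hi (n<1+n (1 + e)))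
       ∣ above (hi<hi (s≤s (s≤s z≤n))) ∣ above (hi<hi z<s)) , refl

    closing-first : Outscores 3 closing (body b 0)
    closing-first =
      (above (lo<hi ≤-refl) ∣ below (hi<lo (s≤s (n≤1+n (1 + e))))
       ∣ above (lo<hi ≤-refl) ∣ above (lo<hi z≤n)) , refl

    inner-penultimate : ∀ {i} → 2 + i ≤ b → Outscores 2 (body b i) penultimate
    inner-penultimate {zero} _ =
      (above (hi<lo z<s) ∣ above (hi<lo ≤-refl)
       ∣ below (lo<hi (s≤s z≤n)) ∣ below (lo<hi z≤n)) , refl
    inner-penultimate {suc i} 3+i≤b =
      (above (hi<lo (m<n⇒0<n∸m (apart⇒< 3+i≤b))) ∣ below (lo<hi (m∸n≤m (2 + e) i))
       ∣ below (lo<hi (≤-trans (swap-≤ (suc i)) (≤-pred 3+i≤b)))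
       ∣ above (hi<lo (s≤s (s≤s z≤n)))) , refl

    inner-closing : ∀ {i} → 1 ≤ i → Outscores 2 (body b i) closing
    inner-closing {suc zero} _ =
      (below (lo<hi (n≤1+n (2 + e))) ∣ above (hi<lo ≤-refl)
       ∣ below (lo<hi z≤n) ∣ above (hi<lo z<s)) , refl
    inner-closing {suc (suc i)} _ =
      (below (lo<hi (m∸n≤m b (2 + i))) ∣ below (lo<hi (m∸n≤m (1 + e) i))
       ∣ above (hi<lo (s≤s (s≤s z≤n))) ∣ above (hi<lo z<s)) , refl

    cyclic : CyclicPattern (suc b) rows
    cyclic = record { step = step ; wrap = wrap ; distant = distant }
      where
      step : ∀ {i} → i < suc b → Outscores 3 (rows i) (rows (suc i))
      step {i} (s≤s i≤b) with m≤n⇒m<n∨m≡n i≤b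
      ... | inj₂ refl = transport rows-penultimate rows-closing penultimate-closing
      ... | inj₁ i<b with m≤n⇒m<n∨m≡n i<b
      ...   | inj₁ 1+i<b = between-body (n<1+n i) 1+i<b (body-step (<⇒≤ 1+i<b))
      ...   | inj₂ refl  = transport (rows-body i<b) rows-penultimate into-penultimate

      wrap : Outscores 3 (rows (suc b)) (rows 0)
      wrap = transport rows-closing refl closing-first

      distant : ∀ {i j} → 2 + i ≤ j → j ≤ suc b → 0 < i ⊎ j < suc b
              → Outscores 2 (rows i) (rows j)
      distant 2+i≤j j≤1+b ends with m≤n⇒m<n∨m≡n j≤1+b | ends
      ... | inj₂ refl | inj₁ 0<i =
        transport (rows-body (≤-pred 2+i≤j)) rows-closing (inner-closing 0<i)
      ... | inj₂ refl | inj₂ b<b = contradiction b<b (<-irrefl refl)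
      ... | inj₁ (s≤s j≤b) | _ with m≤n⇒m<n∨m≡n j≤b
      ...   | inj₂ refl =
        transport (rows-body (apart⇒< 2+i≤j)) rows-penultimate (inner-penultimate 2+i≤j)
      ...   | inj₁ j<b  = between-body (apart⇒< 2+i≤j) j<b (body-distant 2+i≤j j≤b)

    top : ∀ r → r ≤ suc b → rows r c₀ ≤ rows (suc b) c₀
    top r r≤1+b rewrite rows-closing with m≤n⇒m<n∨m≡n r≤1+b
    ... | inj₂ refl rewrite rows-closing = ≤-refl
    ... | inj₁ (s≤s r≤b) with m≤n⇒m<n∨m≡n r≤b
    ...   | inj₂ refl rewrite rows-penultimate = <⇒≤ (hi<hi z<s)
    ...   | inj₁ r<b  rewrite rows-body r<b    = body-low r

    -- column 3 has its minimum lo 0 = 0 in the first row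
    property : Property (suc b) (λ i → rows (toℕ i))
    property = pattern⇒property cyclic c₀ c₃ (λ ()) top (λ _ _ → z≤n)

-- Every m ≥ 3 is 3 + e or 4 + e for an even e (swap e ≡ suc e).
data Shape : ℕ → Set where
  even-rows : ∀ e → swap e ≡ suc e → Shape (3 + e)
  odd-rows  : ∀ e → swap e ≡ suc e → Shape (4 + e)

shape : ∀ k → Shape (3 + k)
shape zero          = even-rows 0 refl
shape (suc zero)    = odd-rows 0 refl
shape (suc (suc k)) with shape k
... | even-rows e e-even = even-rows (2 + e) (cong (λ x → suc (suc x)) e-even)
... | odd-rows  e e-even = odd-rows  (2 + e) (cong (λ x → suc (suc x)) e-even)

lemma4p4 : ∀ (m : ℕ) → suc m ≥ 4 → Σ (Matrix (suc m) 4) λ a → Property m a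
lemma4p4 (suc (suc (suc k))) _ with shape k
... | even-rows e e-even = _ , Construction.EvenRows.property e e-even
... | odd-rows  e e-even = _ , Construction.OddRows.property e e-even
lemma4p4 zero             (s≤s ())
lemma4p4 (suc zero)       (s≤s (s≤s ()))
lemma4p4 (suc (suc zero)) (s≤s (s≤s (s≤s ())))
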